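{- Let $m\ge 0$ be an integer and let $L$ be a Latin square of order $4m+2$. Then either $L$ has no transversal or $L$ has no maximal partial transversal of length $2m+1$. In particular, $L$ is not omniversal.
   Context: A Latin square of order $n$ is an $n\times n$ array on $n$ symbols in which each row and each column contains each symbol exactly once; it is viewed as a set of triples $(r,c,s)$. A partial transversal is a set of triples containing at most one triple in each row, at most one in each column, and at most one with each symbol; its length is its number of triples. It is maximal if not contained in a longer partial transversal. A transversal is a partial transversal of length $n$. A Latin square of order $n$ is omniversal if it has a maximal partial transversal of every length $\ell$ with $\lceil n/2\rceil\le\ell\le n$. -}

module Defs where

open import Data.Nat using (ℕ; _≤_; _+_; _*_; ⌈_/2⌉)
open import Data.Fin using (Fin)
open import Data.Product using (_×_; Σ; ∃; ∃-syntax; proj₁; proj₂)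
open import Data.List using (List; length; map)
open import Data.List.Relation.Unary.Unique.Propositional using (Unique)
open import Data.List.Membership.Propositional using (_∈_)
open import Relation.Nullary using (¬_)
open import Function.Definitions using (Injective; Surjective)
open import Relation.Binary.PropositionalEquality using (_≡_)

record LatinSquare (n : ℕ) : Set where
  field
    sym       : Fin n → Fin n → Fin n
    row-inj   : ∀ r → Injective _≡_ _≡_ (sym r)
    row-surj  : ∀ r → Surjective _≡_ _≡_ (sym r)
    col-inj   : ∀ c → Injective _≡_ _≡_ (λ r → sym r c)
    col-surj  : ∀ c → Surjective _≡_ _≡_ (λ r → sym r c)

open LatinSquare public

Cell : ℕ → Set
Cell n = Fin n × Fin n

triple : ∀ {n} → LatinSquare n → Cell n → Fin n × Fin n × Fin n
triple L (r Data.Product., c) = r Data.Product., c Data.Product., sym L r c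

-- A set of triples of L, represented by a duplicate-free list of cells
-- (a triple of L is determined by its cell).
IsPartialTransversal : ∀ {n} → LatinSquare n → List (Cell n) → Set
IsPartialTransversal L T =
  Unique (map proj₁ T) × Unique (map proj₂ T)
  × Unique (map (λ x → sym L (proj₁ x) (proj₂ x)) T)

IsMaximalPT : ∀ {n} → LatinSquare n → List (Cell n) → Set
IsMaximalPT {n} L T =
  IsPartialTransversal L T ×
  (∀ (T′ : List (Cell n)) → IsPartialTransversal L T′ →
     (∀ {x} → x ∈ T → x ∈ T′) → length T′ ≤ length T)

HasMaximalPTOfLength : ∀ {n} → LatinSquare n → ℕ → Set
HasMaximalPTOfLength {n} L ℓ =
  ∃[ T ] (IsMaximalPT L T × length T ≡ ℓ)

HasTransversal : ∀ {n} → LatinSquare n → Set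
HasTransversal {n} L =
  ∃[ T ] (IsPartialTransversal L T × length T ≡ n)

Omniversal : ∀ {n} → LatinSquare n → Set
Omniversal {n} L = ∀ ℓ → ⌈ n /2⌉ ≤ ℓ → ℓ ≤ n → HasMaximalPTOfLength L ℓ

module Submission where

-- Let P be a maximal partial transversal of length k in a Latin square of
-- order 2k, and call a row, column or symbol used if it occurs in P.  By
-- maximality the k unused rows and k unused columns meet in a subsquare
-- filled with used symbols.  As there are only k used symbols, pigeonhole
-- counts along rows and columns show that the symbol in cell (r , c) is used
-- iff r and c are both used or both unused.  So every cell of a transversal
-- meets one or three of "used row", "used column", "used symbol"; summing
-- over its 2k cells gives 3k = 2k + 2e, where e counts its cells lying in a
-- used row and a used column.  Hence k is even, which fails for k = 2m + 1.

open import Defs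
open import Data.Nat using (ℕ; _+_; _*_)
open import Data.Sum using (_⊎_)
open import Data.Product using (_×_)
open import Relation.Nullary using (¬_)

open import Level using (Level; 0ℓ)
open import Data.Nat using (zero; suc; _≤_; z≤n; s≤s; ⌈_/2⌉)
open import Data.Nat.Properties
  using (suc-injective; ≤-refl; ≤-reflexive; ≤-trans; ≤-antisym; <-irrefl; m≤m+n;
         +-suc; +-assoc; +-cancelˡ-≡; +-cancelʳ-≡; *-comm; n≡⌈n+n/2⌉; ⌈n/2⌉≤n)
open import Data.Nat.Divisibility using (_∣_; divides; >⇒∤; ∣m+n∣m⇒∣n; m∣m*n)
open import Data.Nat.Tactic.RingSolver using (solve-∀)
open import Data.Bool using (true; false)
open import Data.Empty using (⊥-elim)
open import Data.Fin using (Fin; zero; suc)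
open import Data.Fin.Properties using (_≟_; any?; injective⇒≤)
open import Data.Product using (_,_; proj₁; proj₂; ∃; ∃-syntax)
open import Data.Sum using (inj₁; inj₂)
open import Data.List using (List; []; _∷_; length; map; filter; lookup; allFin)
open import Data.List.Properties using (length-map; length-tabulate)
import Data.List.Relation.Unary.All as All
open import Data.List.Relation.Unary.All.Properties using (¬Any⇒All¬)
open import Data.List.Relation.Unary.Any using (here; there; index)
open import Data.List.Relation.Unary.Unique.Propositional using (Unique; _∷_)
open import Data.List.Relation.Unary.Unique.Propositional.Properties
  using (map⁺; filter⁺; allFin⁺)
open import Data.List.Relation.Unary.Unique.DecPropositional using (unique?)
open import Data.List.Relation.Binary.Subset.Propositional using (_⊆_)
open import Data.List.Membership.Propositional using (_∈_; _∉_)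
open import Data.List.Membership.Propositional.Properties
  using (∈-lookup; ∈-map⁻; ∈-filter⁺; ∈-filter⁻; ∈-allFin)
import Data.List.Membership.Setoid.Properties as SetoidMembership
open import Function using (_∘_; id)
open import Function.Bundles using (_⇔_; mk⇔; Equivalence)
open import Function.Definitions using (Injective)
open import Relation.Binary.PropositionalEquality
  using (_≡_; refl; trans; cong; cong₂; subst; subst₂; setoid; module ≡-Reasoning)
  renaming (sym to ≡-sym)
open import Relation.Nullary using (Dec; yes; no; does; contradiction; map′; _×-dec_)
open import Relation.Unary using (Pred; Decidable)
open import Relation.Unary.Properties using (∁?; _∩?_)

private
  variable
    a b p q r : Level
    A : Set a
    B : Set b

Unique⇒lookup-injective : {xs : List A} → Unique xs → Injective _≡_ _≡_ (lookup xs)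
Unique⇒lookup-injective {xs = _ ∷ _} _ {zero} {zero} _ = refl
Unique⇒lookup-injective {xs = _ ∷ _} (x∉xs ∷ _) {zero} {suc j} eq =
  contradiction eq (All.lookup x∉xs (∈-lookup j))
Unique⇒lookup-injective {xs = _ ∷ _} (x∉xs ∷ _) {suc i} {zero} eq =
  contradiction (≡-sym eq) (All.lookup x∉xs (∈-lookup i))
Unique⇒lookup-injective {xs = _ ∷ _} (_ ∷ u) {suc i} {suc j} eq =
  cong suc (Unique⇒lookup-injective u eq)

Unique∧⊆⇒length≤ : {xs ys : List A} → Unique xs → xs ⊆ ys → length xs ≤ length ys
Unique∧⊆⇒length≤ {A = A} {xs} {ys} u xs⊆ys = injective⇒≤ position-injective
  where
  position : Fin (length xs) → Fin (length ys)
  position i = index (xs⊆ys (∈-lookup i))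

  position-injective : Injective _≡_ _≡_ position
  position-injective eq = Unique⇒lookup-injective u
    (SetoidMembership.index-injective (setoid A) (xs⊆ys _) (xs⊆ys _) eq)

pigeonhole-∉ : {h : A → B} {xs : List A} {ys : List B} →
  Injective _≡_ _≡_ h → Unique xs → length ys ≤ length xs →
  (∀ {x} → x ∈ xs → h x ∈ ys) → ∀ {x} → x ∉ xs → h x ∉ ys
pigeonhole-∉ {h = h} {xs} {ys} h-injective u |ys|≤|xs| h[xs]⊆ys {x} x∉xs hx∈ys =
  <-irrefl refl (≤-trans (subst (_≤ length ys) (cong suc (length-map h xs)) image-length) |ys|≤|xs|)
  where
  image⊆ys : map h (x ∷ xs) ⊆ ys
  image⊆ys (here refl) = hx∈ys
  image⊆ys (there y∈) with _ , z∈xs , refl ← ∈-map⁻ h y∈ = h[xs]⊆ys z∈xs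

  image-length : length (map h (x ∷ xs)) ≤ length ys
  image-length = Unique∧⊆⇒length≤ (map⁺ h-injective (¬Any⇒All¬ xs x∉xs ∷ u)) image⊆ys

count : {P : Pred A p} → Decidable P → List A → ℕ
count P? xs = length (filter P? xs)

count-map : {P : Pred B p} (P? : Decidable P) (f : A → B) (xs : List A) →
            count P? (map f xs) ≡ count (P? ∘ f) xs
count-map P? f [] = refl
count-map P? f (x ∷ xs) with does (P? (f x))
... | true  = cong suc (count-map P? f xs)
... | false = count-map P? f xs

count+count∁≡length : {P : Pred A p} (P? : Decidable P) (xs : List A) →
                      count P? xs + count (∁? P?) xs ≡ length xs
count+count∁≡length P? [] = refl
count+count∁≡length P? (x ∷ xs) with does (P? x)
... | true  = cong suc (count+count∁≡length P? xs)
... | false = trans (+-suc _ _) (cong suc (count+count∁≡length P? xs))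

module _ {R : Pred A p} {C : Pred A q} {S : Pred A r}
         (R? : Decidable R) (C? : Decidable C) (S? : Decidable S)
         (S⇔R⇔C : ∀ x → S x ⇔ (R x ⇔ C x)) where

  count-parity : (xs : List A) →
    count R? xs + count C? xs + count S? xs ≡ 2 * count (R? ∩? C?) xs + length xs
  count-parity [] = refl
  count-parity (x ∷ xs) with R? x | C? x | S? x | S⇔R⇔C x | count-parity xs
  ... | yes _ | yes _ | yes _ | _ | ih =
    trans (suc-suc-suc _ _ _) (trans (cong (λ t → 2 + suc t) ih) (2+suc[2e+l] _ _))
    where
    suc-suc-suc : ∀ a b s → suc a + suc b + suc s ≡ 2 + suc (a + b + s)
    suc-suc-suc = solve-∀
    2+suc[2e+l] : ∀ e l → 2 + suc (2 * e + l) ≡ 2 * suc e + suc l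
    2+suc[2e+l] = solve-∀
  ... | yes _ | no _  | no _  | _ | ih = trans (cong suc ih) (≡-sym (+-suc _ _))
  ... | no _  | yes _ | no _  | _ | ih =
    trans (cong (_+ count S? xs) (+-suc _ _)) (trans (cong suc ih) (≡-sym (+-suc _ _)))
  ... | no _  | no _  | yes _ | _ | ih = trans (+-suc _ _) (trans (cong suc ih) (≡-sym (+-suc _ _)))
  ... | yes r | yes c | no ¬s | S⇔ | _ =
    contradiction (Equivalence.from S⇔ (mk⇔ (λ _ → c) (λ _ → r))) ¬s
  ... | yes r | no ¬c | yes s | S⇔ | _ = contradiction (Equivalence.to (Equivalence.to S⇔ s) r) ¬c
  ... | no ¬r | yes c | yes s | S⇔ | _ = contradiction (Equivalence.from (Equivalence.to S⇔ s) c) ¬r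
  ... | no ¬r | no ¬c | no ¬s | S⇔ | _ =
    contradiction (Equivalence.from S⇔ (mk⇔ (⊥-elim ∘ ¬r) (⊥-elim ∘ ¬c))) ¬s

module _ {n : ℕ} where
  open import Data.List.Membership.DecPropositional (_≟_ {n}) using (_∈?_; _∉?_)

  length-allFin : length (allFin n) ≡ n
  length-allFin = length-tabulate id

  Unique∧length≡n⇒complete : {xs : List (Fin n)} → Unique xs → length xs ≡ n → ∀ i → i ∈ xs
  Unique∧length≡n⇒complete {xs} u |xs|≡n i with i ∈? xs
  ... | yes i∈xs = i∈xs
  ... | no  i∉xs = ⊥-elim (<-irrefl refl (subst₂ _≤_ (cong suc |xs|≡n) length-allFin i∷xs-length))
    where
    i∷xs-length : length (i ∷ xs) ≤ length (allFin n)
    i∷xs-length = Unique∧⊆⇒length≤ (¬Any⇒All¬ xs i∉xs ∷ u) (λ {j} _ → ∈-allFin j)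

  count-∈≡length : {xs ys : List (Fin n)} → Unique xs → length xs ≡ n → Unique ys →
                   count (_∈? ys) xs ≡ length ys
  count-∈≡length {xs} {ys} uxs |xs|≡n uys = ≤-antisym
    (Unique∧⊆⇒length≤ (filter⁺ (_∈? ys) uxs) (proj₂ ∘ ∈-filter⁻ (_∈? ys) {xs = xs}))
    (Unique∧⊆⇒length≤ uys λ {y} y∈ys →
      ∈-filter⁺ (_∈? ys) (Unique∧length≡n⇒complete uxs |xs|≡n y) y∈ys)

  complement : List (Fin n) → List (Fin n)
  complement xs = filter (_∉? xs) (allFin n)

  Unique-complement : ∀ xs → Unique (complement xs)
  Unique-complement xs = filter⁺ (_∉? xs) (allFin⁺ n)

  ∈-complement⁺ : ∀ {i xs} → i ∉ xs → i ∈ complement xs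
  ∈-complement⁺ {i} {xs} = ∈-filter⁺ (_∉? xs) (∈-allFin i)

  ∈-complement⁻ : ∀ {i xs} → i ∈ complement xs → i ∉ xs
  ∈-complement⁻ {xs = xs} = proj₂ ∘ ∈-filter⁻ (_∉? xs) {xs = allFin n}

  ∉-complement⁻ : ∀ {i xs} → i ∉ complement xs → i ∈ xs
  ∉-complement⁻ {i} {xs} i∉complement with i ∈? xs
  ... | yes i∈xs = i∈xs
  ... | no  i∉xs = contradiction (∈-complement⁺ i∉xs) i∉complement

  length-complement : ∀ {xs} → Unique xs → length xs + length (complement xs) ≡ n
  length-complement {xs} u = begin
    length xs + length (complement xs)
      ≡⟨ cong (_+ length (complement xs)) (count-∈≡length (allFin⁺ n) length-allFin u) ⟨
    count (_∈? xs) (allFin n) + count (∁? (_∈? xs)) (allFin n)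
      ≡⟨ count+count∁≡length (_∈? xs) (allFin n) ⟩
    length (allFin n)
      ≡⟨ length-allFin ⟩
    n ∎
    where open ≡-Reasoning

module _ {A : Set} (∃? : ∀ {P : Pred A 0ℓ} → Decidable P → Dec (∃ P)) where

  ∃-ofLength? : ∀ k {Q : Pred (List A) 0ℓ} → Decidable Q → Dec (∃[ xs ] Q xs × length xs ≡ k)
  ∃-ofLength? zero    Q? = map′ (λ q → [] , q , refl) (λ { ([] , q , _) → q }) (Q? [])
  ∃-ofLength? (suc k) Q? = map′
    (λ (x , xs , q , |xs|≡k) → x ∷ xs , q , cong suc |xs|≡k)
    (λ { (x ∷ xs , q , |x∷xs|≡1+k) → x , xs , q , suc-injective |x∷xs|≡1+k })
    (∃? λ x → ∃-ofLength? k (Q? ∘ (x ∷_)))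

∃-Cell? : ∀ {n} {P : Pred (Cell n) 0ℓ} → Decidable P → Dec (∃ P)
∃-Cell? P? = map′ (λ (r , c , p) → (r , c) , p) (λ ((r , c) , p) → r , c , p)
  (any? λ r → any? λ c → P? (r , c))

isPartialTransversal? : ∀ {n} (L : LatinSquare n) → Decidable (IsPartialTransversal L)
isPartialTransversal? L T = unique? _≟_ _ ×-dec unique? _≟_ _ ×-dec unique? _≟_ _

hasTransversal? : ∀ {n} (L : LatinSquare n) → Dec (HasTransversal L)
hasTransversal? {n} L = ∃-ofLength? ∃-Cell? n (isPartialTransversal? L)

module HalfLengthMaximal {n k : ℕ} (L : LatinSquare n) (n≡k+k : n ≡ k + k)
  {P : List (Cell n)} (P-maximal : IsMaximalPT L P) (|P|≡k : length P ≡ k) where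

  open import Data.List.Membership.DecPropositional (_≟_ {n}) using (_∈?_)

  symbol : Cell n → Fin n
  symbol (r , c) = sym L r c

  usedRows usedCols usedSymbols : List (Fin n)
  usedRows    = map proj₁ P
  usedCols    = map proj₂ P
  usedSymbols = map symbol P

  private
    P-partial : IsPartialTransversal L P
    P-partial = proj₁ P-maximal

    Unique-usedRows : Unique usedRows
    Unique-usedRows = proj₁ P-partial

    Unique-usedCols : Unique usedCols
    Unique-usedCols = proj₁ (proj₂ P-partial)

    Unique-usedSymbols : Unique usedSymbols
    Unique-usedSymbols = proj₂ (proj₂ P-partial)

  length-used : (f : Cell n → Fin n) → length (map f P) ≡ k
  length-used f = trans (length-map f P) |P|≡k

  length-unused : (f : Cell n → Fin n) → Unique (map f P) → length (complement (map f P)) ≡ k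
  length-unused f u = +-cancelˡ-≡ k _ _ (begin
    k + length (complement (map f P))                ≡⟨ cong (_+ _) (length-used f) ⟨
    length (map f P) + length (complement (map f P)) ≡⟨ length-complement u ⟩
    n                                                ≡⟨ n≡k+k ⟩
    k + k                                            ∎)
    where open ≡-Reasoning

  unused-unused⇒used : ∀ {r c} → r ∉ usedRows → c ∉ usedCols → sym L r c ∈ usedSymbols
  unused-unused⇒used {r} {c} r∉ c∉ with sym L r c ∈? usedSymbols
  ... | yes s∈ = s∈
  ... | no  s∉ = ⊥-elim (<-irrefl refl (proj₂ P-maximal ((r , c) ∷ P) extension there))
    where
    extension : IsPartialTransversal L ((r , c) ∷ P)
    extension = (¬Any⇒All¬ _ r∉ ∷ Unique-usedRows)
              , (¬Any⇒All¬ _ c∉ ∷ Unique-usedCols)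
              , (¬Any⇒All¬ _ s∉ ∷ Unique-usedSymbols)

  unused-used⇒unused : ∀ {r c} → r ∉ usedRows → c ∈ usedCols → sym L r c ∉ usedSymbols
  unused-used⇒unused {r} r∉ c∈ =
    pigeonhole-∉ {ys = usedSymbols} (row-inj L r) (Unique-complement usedCols)
      (≤-reflexive (trans (length-used symbol) (≡-sym (length-unused proj₂ Unique-usedCols))))
      (λ c′∈ → unused-unused⇒used r∉ (∈-complement⁻ c′∈))
      (λ c∈′ → ∈-complement⁻ c∈′ c∈)

  used-unused⇒unused : ∀ {r c} → r ∈ usedRows → c ∉ usedCols → sym L r c ∉ usedSymbols
  used-unused⇒unused {c = c} r∈ c∉ =
    pigeonhole-∉ {ys = usedSymbols} (col-inj L c) (Unique-complement usedRows)
      (≤-reflexive (trans (length-used symbol) (≡-sym (length-unused proj₁ Unique-usedRows))))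
      (λ r′∈ → unused-unused⇒used (∈-complement⁻ r′∈) c∉)
      (λ r∈′ → ∈-complement⁻ r∈′ r∈)

  used-used⇒used : ∀ {r c} → r ∈ usedRows → c ∈ usedCols → sym L r c ∈ usedSymbols
  used-used⇒used {c = c} r∈ c∈ = ∉-complement⁻ (
    pigeonhole-∉ {ys = complement usedSymbols} (col-inj L c) (Unique-complement usedRows)
      (≤-reflexive (trans (length-unused symbol Unique-usedSymbols)
                          (≡-sym (length-unused proj₁ Unique-usedRows))))
      (λ r′∈ → ∈-complement⁺ (unused-used⇒unused (∈-complement⁻ r′∈) c∈))
      (λ r∈′ → ∈-complement⁻ r∈′ r∈))

  symbol-used⇔ : ∀ x → symbol x ∈ usedSymbols ⇔ (proj₁ x ∈ usedRows ⇔ proj₂ x ∈ usedCols)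
  symbol-used⇔ (r , c) with r ∈? usedRows | c ∈? usedCols
  ... | yes r∈ | yes c∈ = mk⇔ (λ _ → mk⇔ (λ _ → c∈) (λ _ → r∈)) (λ _ → used-used⇒used r∈ c∈)
  ... | yes r∈ | no  c∉ =
    mk⇔ (⊥-elim ∘ used-unused⇒unused r∈ c∉) (λ r⇔c → ⊥-elim (c∉ (Equivalence.to r⇔c r∈)))
  ... | no  r∉ | yes c∈ =
    mk⇔ (⊥-elim ∘ unused-used⇒unused r∉ c∈) (λ r⇔c → ⊥-elim (r∉ (Equivalence.from r⇔c c∈)))
  ... | no  r∉ | no  c∉ =
    mk⇔ (λ _ → mk⇔ (⊥-elim ∘ r∉) (⊥-elim ∘ c∉)) (λ _ → unused-unused⇒used r∉ c∉)

  transversal⇒2∣k : HasTransversal L → 2 ∣ k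
  transversal⇒2∣k (T , (Unique-rowsT , Unique-colsT , Unique-symbolsT) , |T|≡n) =
    divides e (trans (+-cancelʳ-≡ (k + k) k (2 * e) (begin
      k + (k + k)                          ≡⟨ +-assoc k k k ⟨
      k + k + k
        ≡⟨ cong₂ _+_ (cong₂ _+_ rows-count cols-count) symbols-count ⟨
      count R? T + count C? T + count S? T ≡⟨ count-parity R? C? S? symbol-used⇔ T ⟩
      2 * e + length T                     ≡⟨ cong (2 * e +_) (trans |T|≡n n≡k+k) ⟩
      2 * e + (k + k)                      ∎)) (*-comm 2 e))
    where
    open ≡-Reasoning
    R? C? S? : Decidable {A = Cell n} _
    R? = (_∈? usedRows) ∘ proj₁
    C? = (_∈? usedCols) ∘ proj₂
    S? = (_∈? usedSymbols) ∘ symbol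

    e : ℕ
    e = count (R? ∩? C?) T

    count-used : (f : Cell n → Fin n) → Unique (map f T) → Unique (map f P) →
                 count ((_∈? map f P) ∘ f) T ≡ k
    count-used f uT uP = begin
      count ((_∈? map f P) ∘ f) T   ≡⟨ count-map (_∈? map f P) f T ⟨
      count (_∈? map f P) (map f T) ≡⟨ count-∈≡length uT (trans (length-map f T) |T|≡n) uP ⟩
      length (map f P)              ≡⟨ length-used f ⟩
      k                             ∎

    rows-count    = count-used proj₁ Unique-rowsT Unique-usedRows
    cols-count    = count-used proj₂ Unique-colsT Unique-usedCols
    symbols-count = count-used symbol Unique-symbolsT Unique-usedSymbols

transversal∧maximal⇒2∣ : ∀ {n k} → n ≡ k + k → (L : LatinSquare n) →
  HasTransversal L → HasMaximalPTOfLength L k → 2 ∣ k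
transversal∧maximal⇒2∣ n≡k+k L t (P , P-maximal , |P|≡k) =
  HalfLengthMaximal.transversal⇒2∣k L n≡k+k P-maximal |P|≡k t

4m+2≡[2m+1]+[2m+1] : ∀ m → 4 * m + 2 ≡ (2 * m + 1) + (2 * m + 1)
4m+2≡[2m+1]+[2m+1] = solve-∀

2∤2m+1 : ∀ m → ¬ 2 ∣ 2 * m + 1
2∤2m+1 m 2∣2m+1 = >⇒∤ (s≤s (s≤s z≤n)) (∣m+n∣m⇒∣n 2∣2m+1 (m∣m*n m))

theorem2p1 : (m : ℕ) (L : LatinSquare (4 * m + 2)) →
    ((¬ HasTransversal L) ⊎ (¬ HasMaximalPTOfLength L (2 * m + 1)))
    × (¬ Omniversal L)
theorem2p1 m L = dichotomy , not-omniversal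
  where
  n = 4 * m + 2
  k = 2 * m + 1
  n≡k+k : n ≡ k + k
  n≡k+k = 4m+2≡[2m+1]+[2m+1] m

  incompatible : HasTransversal L → ¬ HasMaximalPTOfLength L k
  incompatible t = 2∤2m+1 m ∘ transversal∧maximal⇒2∣ n≡k+k L t

  dichotomy : (¬ HasTransversal L) ⊎ (¬ HasMaximalPTOfLength L k)
  dichotomy with hasTransversal? L
  ... | yes t = inj₂ (incompatible t)
  ... | no ¬t = inj₁ ¬t

  not-omniversal : ¬ Omniversal L
  not-omniversal omniversal = incompatible transversal (omniversal k (≤-reflexive ⌈n/2⌉≡k) k≤n)
    where
    ⌈n/2⌉≡k : ⌈ n /2⌉ ≡ k
    ⌈n/2⌉≡k = trans (cong ⌈_/2⌉ n≡k+k) (≡-sym (n≡⌈n+n/2⌉ k))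
    k≤n : k ≤ n
    k≤n = subst (k ≤_) (≡-sym n≡k+k) (m≤m+n k k)
    transversal : HasTransversal L
    transversal with T , (T-partial , _) , |T|≡n ← omniversal n (⌈n/2⌉≤n n) ≤-refl =
      T , T-partial , |T|≡n
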